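{- Let $p$ be a prime, $f,g:\mathbb{F}_p^n\rightarrow\mathbb{F}_p$ and $\mathcal{E}=\{e_1,\dots,e_n\}$ a basis of $\mathbb{F}_p^n$ over $\mathbb{F}_p$, with coordinates $x_1,\dots,x_n$ relative to $\mathcal{E}$. Suppose that for some $i\neq j \in\{1,\dots,n\}$, \[ \Delta_{e_i}f(x_1,\dots,x_n) = \Delta_{e_j} g(x_1,\dots,x_n)\quad\text{for all }(x_1,\dots,x_n).\] Then \[\deg_{x_j} (\Delta_{e_i} f) = \deg_{x_j}(\Delta_{e_j}g) < p-1 \quad\text{and}\quad \deg_{x_i} (\Delta_{e_j} g) = \deg_{x_i}(\Delta_{e_i}f) < p-1.\]
   Context: $\Delta_{a}f(x)=f(x+a)-f(x)$. Every function $h:\mathbb{F}_p^n\to\mathbb{F}_p$, written in coordinates relative to $\mathcal{E}$, has a unique algebraic normal form $h(x_1,\dots,x_n)=\sum_{(i_1,\dots,i_n)\in\{0,\dots,p-1\}^n} h_{(i_1,\dots,i_n)}\prod_{k=1}^n x_k^{i_k}$, and $\deg_{x_k}(h)=\max\{i_k \mid h_{(i_1,\dots,i_n)}\neq 0\}$. -}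

module Defs where

open import Data.Nat using (ℕ; zero; suc; _+_; _*_; _∸_; _⊔_; NonZero)
open import Data.Nat.DivMod using (_%_; m%n<n)
open import Data.Nat.Primality using (Prime; prime⇒nonZero)
open import Data.Fin using (Fin; toℕ; fromℕ<; _≟_)
open import Data.List using (List; []; _∷_; map; concatMap; foldr)
open import Data.Vec using (Vec; []; _∷_; zipWith; tabulate; lookup)
open import Data.Bool using (if_then_else_)
open import Relation.Nullary using (does)
open import Relation.Binary.PropositionalEquality using (_≡_)

module PrimeField (p : ℕ) (pp : Prime p) where

  instance
    nz : NonZero p
    nz = prime⇒nonZero pp

  F : Set
  F = Fin p

  red : ℕ → F
  red m = fromℕ< (m%n<n m p)

  0F : F
  0F = red 0

  1F : F
  1F = red 1

  _+F_ : F → F → F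
  a +F b = red (toℕ a + toℕ b)

  _*F_ : F → F → F
  a *F b = red (toℕ a * toℕ b)

  _-F_ : F → F → F
  a -F b = red (toℕ a + (p ∸ toℕ b))

  _^F_ : F → ℕ → F
  a ^F zero = 1F
  a ^F suc k = a *F (a ^F k)

  _+V_ : ∀ {n} → Vec F n → Vec F n → Vec F n
  _+V_ = zipWith _+F_

  -- the basis vector e_i, in coordinates relative to E
  e : ∀ {n} → Fin n → Vec F n
  e i = tabulate (λ k → if does (k ≟ i) then 1F else 0F)

  Δ : ∀ {n} → Vec F n → (Vec F n → F) → Vec F n → F
  Δ a h x = h (x +V a) -F h x

  allExps : (n : ℕ) → List (Vec (Fin p) n)
  allExps zero = [] ∷ []
  allExps (suc n) =
    concatMap (λ a → map (a ∷_) (allExps n)) (Data.List.allFin p)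

  monomial : ∀ {n} → Vec (Fin p) n → Vec F n → F
  monomial [] [] = 1F
  monomial (i ∷ is) (x ∷ xs) = (x ^F toℕ i) *F monomial is xs

  sumF : List F → F
  sumF = foldr _+F_ 0F

  IsANF : ∀ {n} → (Vec (Fin p) n → F) → (Vec F n → F) → Set
  IsANF {n} c h = ∀ x → h x ≡ sumF (map (λ is → c is *F monomial is x) (allExps n))

  -- deg_{x_k} : max { i_k | c_{(i_1..i_n)} ≠ 0 }  (0 if c is identically 0)
  degIn : ∀ {n} → Fin n → (Vec (Fin p) n → F) → ℕ
  degIn {n} k c =
    foldr _⊔_ 0
      (map (λ is → if does (c is ≟ 0F) then 0 else toℕ (lookup is k)) (allExps n))

module Submission where

-- The two finite differences are the same function, and the algebraic normal form of a
-- function 𝔽_p^n → 𝔽_p is unique (a polynomial of degree < p in one variable is determined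
-- by its values on 𝔽_p), so cf = cg. For the degree bound, freeze every coordinate except
-- x_j: Δ_{e_j} g becomes t ↦ G (t + 1) − G t for some G : 𝔽_p → 𝔽_p. By Lagrange
-- interpolation G is a polynomial of degree < p, and the Taylor shift X ↦ X + 1 does not
-- change its leading coefficient, so G (X + 1) − G X has no X^(p−1) term. By uniqueness
-- again, the coefficients of x_j^(p−1) in the ANF of Δ_{e_j} g vanish.

open import Algebra using (CommutativeRing; Semiring)
open import Algebra.Consequences.Propositional
  using (comm∧idˡ⇒id; comm∧invˡ⇒inv; comm∧distrʳ⇒distr)
open import Algebra.Core using (Op₁; Op₂)
open import Algebra.Solver.Ring.AlmostCommutativeRing
  using (fromCommutativeRing; _-Raw-AlmostCommutative⟶_)
open import Algebra.Structures using (IsCommutativeRing)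
open import Data.Bool.Base using (if_then_else_)
open import Data.Fin.Base using (Fin; zero; suc; toℕ; fromℕ; punchIn)
open import Data.Fin.Properties
  using (_≟_; toℕ-injective; toℕ-fromℕ<; toℕ-fromℕ; toℕ<n; toℕ≤pred[n]; suc-injective; punchInᵢ≢i)
open import Data.Integer.Base as ℤ using (ℤ; -[1+_]; 0ℤ; _⊖_; _◃_)
open import Data.Integer.Properties using ([1+m]⊖[1+n]≡m⊖n) renaming (_≟_ to _≟ℤ_)
open import Data.List.Base as List using (List; []; _∷_; map; concatMap; allFin)
open import Data.List.Properties using (map-cong; map-∘; foldr-preservesᵇ)
import Data.List.Relation.Unary.All as All
import Data.List.Relation.Unary.All.Properties as All
open import Data.Maybe.Base using (Maybe; just; nothing)
open import Data.Nat.Base as ℕ using (ℕ; zero; suc; _∸_; _<_; _⊔_)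
open import Data.Nat.Coprimality using (prime⇒coprime; coprime-Bézout)
open import Data.Nat.Divisibility using (_∣_; m%n≡0⇒n∣m; >⇒∤)
open import Data.Nat.DivMod
  using (_%_; n%n≡0; m<n⇒m%n≡m; m%n%n≡m%n; %-distribˡ-+; %-distribˡ-*)
open import Data.Nat.GCD using (module Bézout)
open import Data.Nat.Primality using (Prime; euclidsLemma; prime⇒nonTrivial; ¬prime[0])
import Data.Nat.Properties as ℕₚ
open import Data.Product.Base using (_×_; _,_; proj₁; proj₂; ∃-syntax)
open import Data.Sign.Base as Sign using (Sign)
open import Data.Sum.Base as Sum using (_⊎_; inj₁; inj₂)
open import Data.Vec.Base using (Vec; []; _∷_; lookup; tabulate; zipWith)
open import Data.Vec.Properties using (lookup∘tabulate; lookup-zipWith)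
open import Function.Base using (_∘_; id)
open import Function.Definitions using (Injective)
import Relation.Binary.PropositionalEquality as ≡
open ≡ using (_≡_; _≢_; refl; module ≡-Reasoning)
open import Relation.Nullary using (yes; no; does; contradiction)

open import Defs

-- Integer coefficients for Algebra.Solver.Ring: coefficients taken from 𝔽_p itself would
-- not compute, since its arithmetic is modulo a variable p.
module RingSolver {c ℓ} (R : CommutativeRing c ℓ) where
  open CommutativeRing R renaming (refl to ≈-refl)
  open import Algebra.Properties.Semiring.Mult semiring
    using (×-homo-+; ×1-homo-*) renaming (_×_ to _·_)
  open import Algebra.Properties.Ring ring using (-‿distribˡ-*; -‿distribʳ-*)
  open import Algebra.Properties.AbelianGroup +-abelianGroup
    using (⁻¹-∙-comm; ε⁻¹≈ε; ⁻¹-involutive)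
  open import Relation.Binary.Reasoning.Setoid setoid

  private
    signed : Sign → Carrier → Carrier
    signed Sign.+ x = x
    signed Sign.- x = - x

    fromℤ : ℤ → Carrier
    fromℤ i = signed (ℤ.sign i) (ℤ.∣ i ∣ · 1#)

    ⊖-homo : ∀ m n → fromℤ (m ⊖ n) ≈ m · 1# - n · 1#
    ⊖-homo zero    zero    = sym (-‿inverseʳ 0#)
    ⊖-homo (suc m) zero    = sym (trans (+-congˡ ε⁻¹≈ε) (+-identityʳ _))
    ⊖-homo zero    (suc n) = sym (+-identityˡ _)
    ⊖-homo (suc m) (suc n) = begin
      fromℤ (suc m ⊖ suc n)     ≡⟨ ≡.cong fromℤ ([1+m]⊖[1+n]≡m⊖n m n) ⟩
      fromℤ (m ⊖ n)             ≈⟨ ⊖-homo m n ⟩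
      x + - y                   ≈⟨ +-congˡ (+-identityˡ _) ⟨
      x + (0# + - y)            ≈⟨ +-congˡ (+-congʳ (-‿inverseʳ 1#)) ⟨
      x + ((1# + - 1#) + - y)   ≈⟨ +-congˡ (+-assoc _ _ _) ⟩
      x + (1# + (- 1# + - y))   ≈⟨ +-assoc _ _ _ ⟨
      (x + 1#) + (- 1# + - y)   ≈⟨ +-cong (+-comm _ _) (⁻¹-∙-comm _ _) ⟩
      (1# + x) - (1# + y)       ∎
      where x = m · 1#
            y = n · 1#

    ◃-homo : ∀ s n → fromℤ (s ◃ n) ≈ signed s (n · 1#)
    ◃-homo Sign.+ zero    = ≈-refl
    ◃-homo Sign.- zero    = sym ε⁻¹≈ε
    ◃-homo Sign.+ (suc n) = ≈-refl
    ◃-homo Sign.- (suc n) = ≈-refl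

    signed-* : ∀ s t x y → signed (s Sign.* t) (x * y) ≈ signed s x * signed t y
    signed-* Sign.+ Sign.+ x y = ≈-refl
    signed-* Sign.+ Sign.- x y = -‿distribʳ-* x y
    signed-* Sign.- Sign.+ x y = -‿distribˡ-* x y
    signed-* Sign.- Sign.- x y = begin
      x * y         ≈⟨ ⁻¹-involutive _ ⟨
      - - (x * y)   ≈⟨ -‿cong (-‿distribˡ-* x y) ⟩
      - (- x * y)   ≈⟨ -‿distribʳ-* (- x) y ⟩
      - x * - y     ∎

    +-homo : ∀ i j → fromℤ (i ℤ.+ j) ≈ fromℤ i + fromℤ j
    +-homo (ℤ.+ m)  (ℤ.+ n)  = ×-homo-+ 1# m n
    +-homo (ℤ.+ m)  -[1+ n ] = ⊖-homo m (suc n)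
    +-homo -[1+ m ] (ℤ.+ n)  = trans (⊖-homo n (suc m)) (+-comm _ _)
    +-homo -[1+ m ] -[1+ n ] = begin
      - (suc (suc (m ℕ.+ n)) · 1#)      ≡⟨ ≡.cong (λ k → - (k · 1#)) (ℕₚ.+-suc (suc m) n) ⟨
      - ((suc m ℕ.+ suc n) · 1#)        ≈⟨ -‿cong (×-homo-+ 1# (suc m) (suc n)) ⟩
      - (suc m · 1# + suc n · 1#)       ≈⟨ ⁻¹-∙-comm _ _ ⟨
      - (suc m · 1#) + - (suc n · 1#)   ∎

    *-homo : ∀ i j → fromℤ (i ℤ.* j) ≈ fromℤ i * fromℤ j
    *-homo i j = begin
      fromℤ (s ◃ m ℕ.* n)          ≈⟨ ◃-homo s (m ℕ.* n) ⟩
      signed s ((m ℕ.* n) · 1#)     ≈⟨ signed-cong s (×1-homo-* m n) ⟩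
      signed s (m · 1# * n · 1#)    ≈⟨ signed-* (ℤ.sign i) (ℤ.sign j) _ _ ⟩
      fromℤ i * fromℤ j             ∎
      where
      s = ℤ.sign i Sign.* ℤ.sign j
      m = ℤ.∣ i ∣
      n = ℤ.∣ j ∣
      signed-cong : ∀ s {x y} → x ≈ y → signed s x ≈ signed s y
      signed-cong Sign.+ x≈y = x≈y
      signed-cong Sign.- x≈y = -‿cong x≈y

    -‿homo : ∀ i → fromℤ (ℤ.- i) ≈ - fromℤ i
    -‿homo (ℤ.+ zero)  = sym ε⁻¹≈ε
    -‿homo (ℤ.+ suc n) = ≈-refl
    -‿homo -[1+ n ]    = sym (⁻¹-involutive _)

    homomorphism : ℤ.+-*-rawRing -Raw-AlmostCommutative⟶ fromCommutativeRing R
    homomorphism = record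
      { ⟦_⟧ = fromℤ ; +-homo = +-homo ; *-homo = *-homo ; -‿homo = -‿homo
      ; 0-homo = ≈-refl ; 1-homo = +-identityʳ 1# }

    dec : ∀ i j → Maybe (fromℤ i ≈ fromℤ j)
    dec i j with i ≟ℤ j
    ... | yes ≡.refl = just ≈-refl
    ... | no _       = nothing

  open import Algebra.Solver.Ring ℤ.+-*-rawRing (fromCommutativeRing R) homomorphism dec public

module Polynomials {ℓ} {A : Set ℓ} {add mul : Op₂ A} {neg : Op₁ A} {0ᴬ 1ᴬ : A}
  (isCommutativeRing : IsCommutativeRing _≡_ add mul neg 0ᴬ 1ᴬ) where

  commutativeRing : CommutativeRing ℓ ℓ
  commutativeRing = record { isCommutativeRing = isCommutativeRing }

  open CommutativeRing commutativeRing
    using (_+_; _*_; -_; _-_; 0#; 1#; +-assoc; *-assoc; +-identityʳ; *-identityʳ; -‿inverseʳ;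
           semiring; +-group)
  open import Algebra.Definitions.RawSemiring (Semiring.rawSemiring semiring) public using (_^_)
  open import Algebra.Properties.Semiring.Sum semiring
    using (sum; sum-syntax; sum-cong-≗; ∑-comm; *-distribˡ-sum; *-distribʳ-sum;
           sum-remove; sum-replicate-zero)
  open RingSolver commutativeRing
  open ≡-Reasoning

  eval : ∀ {L} → Vec A L → A → A
  eval []       t = 0#
  eval (b ∷ bs) t = b + t * eval bs t

  infixr 5 _+ₕ_

  _+ₕ_ : ∀ {L} → A → Vec A (suc L) → Vec A (suc L)
  c +ₕ (b ∷ bs) = (c + b) ∷ bs

  mulLinear : ∀ {L} → A → Vec A L → Vec A (suc L)
  mulLinear β []       = 0# ∷ []
  mulLinear β (r ∷ rs) = β * r ∷ r +ₕ mulLinear β rs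

  shift : ∀ {L} → A → Vec A L → Vec A L
  shift β []       = []
  shift β (b ∷ bs) = b +ₕ mulLinear β (shift β bs)

  divide : ∀ {L} → A → Vec A (suc L) → Vec A L
  divide a (b ∷ [])      = []
  divide a (b ∷ b′ ∷ bs) = eval (b′ ∷ bs) a ∷ divide a (b′ ∷ bs)

  withRoots : ∀ {m} → (Fin m → A) → Vec A (suc m)
  withRoots {zero}  r = 1# ∷ []
  withRoots {suc m} r = mulLinear (- r zero) (withRoots (r ∘ suc))

  eval-+ₕ : ∀ {L} c (b : Vec A (suc L)) t → eval (c +ₕ b) t ≡ c + eval b t
  eval-+ₕ c (b ∷ bs) t = +-assoc c b (t * eval bs t)

  eval-mulLinear : ∀ {L} β (r : Vec A L) t → eval (mulLinear β r) t ≡ (t + β) * eval r t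
  eval-mulLinear β [] t =
    solve 2 (λ t β → con 0ℤ :+ t :* con 0ℤ := (t :+ β) :* con 0ℤ) refl t β
  eval-mulLinear β (r ∷ rs) t = begin
    β * r + t * eval (r +ₕ mulLinear β rs) t
      ≡⟨ ≡.cong (λ x → β * r + t * x) (eval-+ₕ r (mulLinear β rs) t) ⟩
    β * r + t * (r + eval (mulLinear β rs) t)
      ≡⟨ ≡.cong (λ x → β * r + t * (r + x)) (eval-mulLinear β rs t) ⟩
    β * r + t * (r + (t + β) * eval rs t)
      ≡⟨ solve 4 (λ β r t x → β :* r :+ t :* (r :+ (t :+ β) :* x) := (t :+ β) :* (r :+ t :* x))
                 refl β r t (eval rs t) ⟩
    (t + β) * (r + t * eval rs t)
      ∎

  eval-shift : ∀ {L} β (b : Vec A L) t → eval (shift β b) t ≡ eval b (t + β)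
  eval-shift β []       t = refl
  eval-shift β (b ∷ bs) t = begin
    eval (b +ₕ mulLinear β (shift β bs)) t   ≡⟨ eval-+ₕ b (mulLinear β (shift β bs)) t ⟩
    b + eval (mulLinear β (shift β bs)) t    ≡⟨ ≡.cong (b +_) (eval-mulLinear β (shift β bs) t) ⟩
    b + (t + β) * eval (shift β bs) t        ≡⟨ ≡.cong (λ x → b + (t + β) * x) (eval-shift β bs t) ⟩
    b + (t + β) * eval bs (t + β)            ∎

  lookup-mulLinear-last : ∀ {L} β (r : Vec A (suc L)) →
                          lookup (mulLinear β r) (fromℕ (suc L)) ≡ lookup r (fromℕ L)
  lookup-mulLinear-last β (r ∷ [])      = +-identityʳ r
  lookup-mulLinear-last β (r ∷ r′ ∷ rs) = lookup-mulLinear-last β (r′ ∷ rs)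

  lookup-shift-last : ∀ {L} β (b : Vec A (suc L)) →
                      lookup (shift β b) (fromℕ L) ≡ lookup b (fromℕ L)
  lookup-shift-last β (b ∷ [])              = +-identityʳ b
  lookup-shift-last {suc L} β (b ∷ b′ ∷ bs) = begin
    lookup (b +ₕ mulLinear β s) (fromℕ (suc L))   ≡⟨ lookup-+ₕ-suc (mulLinear β s) ⟩
    lookup (mulLinear β s) (fromℕ (suc L))        ≡⟨ lookup-mulLinear-last β s ⟩
    lookup s (fromℕ L)                            ≡⟨ lookup-shift-last β (b′ ∷ bs) ⟩
    lookup (b′ ∷ bs) (fromℕ L)                    ∎
    where
    s = shift β (b′ ∷ bs)
    lookup-+ₕ-suc : ∀ {L} {i : Fin L} (v : Vec A (suc L)) → lookup (b +ₕ v) (suc i) ≡ lookup v (suc i)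
    lookup-+ₕ-suc (_ ∷ _) = refl

  divide-correct : ∀ {L} a (b : Vec A (suc L)) → b ≡ eval b a +ₕ mulLinear (- a) (divide a b)
  divide-correct a (b ∷ []) =
    ≡.cong (_∷ []) (solve 2 (λ b a → b := b :+ a :* con 0ℤ :+ con 0ℤ) refl b a)
  divide-correct a (b ∷ b′ ∷ bs) =
    ≡.cong₂ _∷_ (solve 3 (λ b a B → b := b :+ a :* B :+ :- a :* B) refl b a (eval (b′ ∷ bs) a))
                (divide-correct a (b′ ∷ bs))

  eval-divide : ∀ {L} a (b : Vec A (suc L)) t →
                eval b t ≡ eval b a + (t - a) * eval (divide a b) t
  eval-divide a b t = begin
    eval b t                               ≡⟨ ≡.cong (λ v → eval v t) (divide-correct a b) ⟩
    eval (eval b a +ₕ mulLinear (- a) d) t ≡⟨ eval-+ₕ (eval b a) (mulLinear (- a) d) t ⟩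
    eval b a + eval (mulLinear (- a) d) t  ≡⟨ ≡.cong (eval b a +_) (eval-mulLinear (- a) d t) ⟩
    eval b a + (t - a) * eval d t          ∎
    where d = divide a b

  eval-withRoots : ∀ {m} (r : Fin m → A) k → eval (withRoots r) (r k) ≡ 0#
  eval-withRoots {suc m} r k = begin
    eval (mulLinear (- r zero) (withRoots (r ∘ suc))) (r k)
      ≡⟨ eval-mulLinear (- r zero) (withRoots (r ∘ suc)) (r k) ⟩
    (r k - r zero) * eval (withRoots (r ∘ suc)) (r k)
      ≡⟨ vanishes k ⟩
    0#
      ∎
    where
    vanishes : ∀ k → (r k - r zero) * eval (withRoots (r ∘ suc)) (r k) ≡ 0#
    vanishes zero    =
      solve 2 (λ x v → (x :- x) :* v := con 0ℤ) refl (r zero) (eval (withRoots (r ∘ suc)) (r zero))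
    vanishes (suc k) = begin
      (r (suc k) - r zero) * eval (withRoots (r ∘ suc)) (r (suc k))
        ≡⟨ ≡.cong ((r (suc k) - r zero) *_) (eval-withRoots (r ∘ suc) k) ⟩
      (r (suc k) - r zero) * 0#
        ≡⟨ solve 1 (λ x → x :* con 0ℤ := con 0ℤ) refl (r (suc k) - r zero) ⟩
      0#
        ∎

  eval-zipWith-sub : ∀ {L} (b c : Vec A L) t → eval (zipWith _-_ b c) t ≡ eval b t - eval c t
  eval-zipWith-sub []       []       t = solve 0 (con 0ℤ := con 0ℤ :- con 0ℤ) refl
  eval-zipWith-sub (b ∷ bs) (c ∷ cs) t = begin
    (b - c) + t * eval (zipWith _-_ bs cs) t
      ≡⟨ ≡.cong (λ x → (b - c) + t * x) (eval-zipWith-sub bs cs t) ⟩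
    (b - c) + t * (eval bs t - eval cs t)
      ≡⟨ solve 5 (λ b c t x y → (b :- c) :+ t :* (x :- y) := (b :+ t :* x) :- (c :+ t :* y))
                 refl b c t (eval bs t) (eval cs t) ⟩
    (b + t * eval bs t) - (c + t * eval cs t)
      ∎

  eval-zeros : ∀ {L} t → eval (tabulate {n = L} λ _ → 0#) t ≡ 0#
  eval-zeros {zero}  t = refl
  eval-zeros {suc L} t = begin
    0# + t * eval (tabulate {n = L} λ _ → 0#) t   ≡⟨ ≡.cong (λ x → 0# + t * x) (eval-zeros {L} t) ⟩
    0# + t * 0#                                   ≡⟨ solve 1 (λ t → con 0ℤ :+ t :* con 0ℤ := con 0ℤ) refl t ⟩
    0#                                            ∎

  eval≡∑ : ∀ {L} (b : Vec A L) t → eval b t ≡ ∑[ k < L ] (lookup b k * t ^ toℕ k)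
  eval≡∑ []       t = refl
  eval≡∑ {suc L} (b ∷ bs) t = begin
    b + t * eval bs t
      ≡⟨ ≡.cong₂ (λ x y → x + t * y) (*-identityʳ b) (≡.sym (eval≡∑ bs t)) ⟨
    b * 1# + t * ∑[ k < L ] (lookup bs k * t ^ toℕ k)
      ≡⟨ ≡.cong (b * 1# +_) (*-distribˡ-sum t λ k → lookup bs k * t ^ toℕ k) ⟩
    b * 1# + ∑[ k < L ] (t * (lookup bs k * t ^ toℕ k))
      ≡⟨ ≡.cong (b * 1# +_) (sum-cong-≗ λ k →
           solve 3 (λ t x y → t :* (x :* y) := x :* (t :* y)) refl t (lookup bs k) (t ^ toℕ k)) ⟩
    b * 1# + ∑[ k < L ] (lookup bs k * (t * t ^ toℕ k))
      ∎

  eval-tabulate : ∀ {L} (c : Fin L → A) t → eval (tabulate c) t ≡ ∑[ k < L ] (c k * t ^ toℕ k)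
  eval-tabulate c t = ≡.trans (eval≡∑ (tabulate c) t)
                              (sum-cong-≗ λ k → ≡.cong (_* t ^ toℕ k) (lookup∘tabulate c k))

  eval-∑ : ∀ {m L} (w : Fin m → A) (P : Fin m → Vec A L) t →
           eval (tabulate λ k → ∑[ a < m ] (w a * lookup (P a) k)) t ≡ ∑[ a < m ] (w a * eval (P a) t)
  eval-∑ {m} {L} w P t = begin
    eval (tabulate λ k → ∑[ a < m ] (w a * lookup (P a) k)) t
      ≡⟨ eval-tabulate (λ k → ∑[ a < m ] (w a * lookup (P a) k)) t ⟩
    ∑[ k < L ] (∑[ a < m ] (w a * lookup (P a) k) * t ^ toℕ k)
      ≡⟨ sum-cong-≗ (λ k → *-distribʳ-sum (t ^ toℕ k) λ a → w a * lookup (P a) k) ⟩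
    ∑[ k < L ] ∑[ a < m ] (w a * lookup (P a) k * t ^ toℕ k)
      ≡⟨ ∑-comm (λ k a → w a * lookup (P a) k * t ^ toℕ k) ⟩
    ∑[ a < m ] ∑[ k < L ] (w a * lookup (P a) k * t ^ toℕ k)
      ≡⟨ sum-cong-≗ (λ a → sum-cong-≗ λ k → *-assoc (w a) (lookup (P a) k) (t ^ toℕ k)) ⟩
    ∑[ a < m ] ∑[ k < L ] (w a * (lookup (P a) k * t ^ toℕ k))
      ≡⟨ sum-cong-≗ (λ a → *-distribˡ-sum (w a) λ k → lookup (P a) k * t ^ toℕ k) ⟨
    ∑[ a < m ] (w a * ∑[ k < L ] (lookup (P a) k * t ^ toℕ k))
      ≡⟨ sum-cong-≗ (λ a → ≡.cong (w a *_) (eval≡∑ (P a) t)) ⟨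
    ∑[ a < m ] (w a * eval (P a) t)
      ∎

  sum-pick : ∀ {n} (f : Fin (suc n) → A) i → (∀ j → j ≢ i → f j ≡ 0#) → sum f ≡ f i
  sum-pick {n} f i others = begin
    sum f                       ≡⟨ sum-remove {i = i} f ⟩
    f i + sum (f ∘ punchIn i)   ≡⟨ ≡.cong (f i +_) (sum-cong-≗ λ j → others (punchIn i j) (punchInᵢ≢i i j)) ⟩
    f i + sum {n} (λ _ → 0#)    ≡⟨ ≡.cong (f i +_) (sum-replicate-zero n) ⟩
    f i + 0#                    ≡⟨ +-identityʳ (f i) ⟩
    f i                         ∎

  module IntegralDomain (1≢0 : 1# ≢ 0#) (zero-product : ∀ {x y} → x * y ≡ 0# → x ≡ 0# ⊎ y ≡ 0#) where

    open import Algebra.Properties.Group +-group using (x∙y⁻¹≈ε⇒x≈y; ∙-cancelˡ)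

    *-cancelˡ-nonzero : ∀ {x y z} → x ≢ 0# → x * y ≡ x * z → y ≡ z
    *-cancelˡ-nonzero {x} {y} {z} x≢0 xy≡xz with zero-product (begin
        x * (y - z)     ≡⟨ solve 3 (λ x y z → x :* (y :- z) := x :* y :- x :* z) refl x y z ⟩
        x * y - x * z   ≡⟨ ≡.cong (_- x * z) xy≡xz ⟩
        x * z - x * z   ≡⟨ -‿inverseʳ (x * z) ⟩
        0#              ∎)
    ... | inj₁ x≡0   = contradiction x≡0 x≢0
    ... | inj₂ y-z≡0 = x∙y⁻¹≈ε⇒x≈y y z y-z≡0

    -- Dividing by X − pt 0 reduces to polynomials of smaller length agreeing on pt ∘ suc.
    eval-injective : ∀ {L} (pt : Fin L → A) → Injective _≡_ _≡_ pt →
                     (b c : Vec A L) → (∀ k → eval b (pt k) ≡ eval c (pt k)) → b ≡ c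
    eval-injective {zero}  pt inj [] [] agree = refl
    eval-injective {suc L} pt inj b c agree = begin
      b                                          ≡⟨ divide-correct a b ⟩
      eval b a +ₕ mulLinear (- a) (divide a b)   ≡⟨ ≡.cong₂ (λ x d → x +ₕ mulLinear (- a) d)
                                                            (agree zero) quotients-agree ⟩
      eval c a +ₕ mulLinear (- a) (divide a c)   ≡⟨ divide-correct a c ⟨
      c                                          ∎
      where
      a = pt zero
      quotients-agree : divide a b ≡ divide a c
      quotients-agree = eval-injective (pt ∘ suc) (suc-injective ∘ inj) (divide a b) (divide a c) λ k →
        let t = pt (suc k) in
        *-cancelˡ-nonzero (λ t-a≡0 → contradiction (inj (x∙y⁻¹≈ε⇒x≈y t a t-a≡0)) λ ())
          (∙-cancelˡ (eval b a) _ _ (begin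
            eval b a + (t - a) * eval (divide a b) t   ≡⟨ eval-divide a b t ⟨
            eval b t                                   ≡⟨ agree (suc k) ⟩
            eval c t                                   ≡⟨ eval-divide a c t ⟩
            eval c a + (t - a) * eval (divide a c) t   ≡⟨ ≡.cong (_+ (t - a) * eval (divide a c) t) (agree zero) ⟨
            eval b a + (t - a) * eval (divide a c) t   ∎))

    eval-tabulate-injective : ∀ {L} (pt : Fin L → A) → Injective _≡_ _≡_ pt → (f g : Fin L → A) →
                              (∀ k → eval (tabulate f) (pt k) ≡ eval (tabulate g) (pt k)) →
                              ∀ i → f i ≡ g i
    eval-tabulate-injective pt inj f g agree i = begin
      f i                     ≡⟨ lookup∘tabulate f i ⟨
      lookup (tabulate f) i   ≡⟨ ≡.cong (λ v → lookup v i)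
                                        (eval-injective pt inj (tabulate f) (tabulate g) agree) ⟩
      lookup (tabulate g) i   ≡⟨ lookup∘tabulate g i ⟩
      g i                     ∎

    eval-withRoots-nonroot : ∀ {m} (r : Fin m → A) t → (∀ k → t ≢ r k) → eval (withRoots r) t ≢ 0#
    eval-withRoots-nonroot {zero} r t _ ≡0 =
      1≢0 (≡.trans (solve 2 (λ o t → o := o :+ t :* con 0ℤ) refl 1# t) ≡0)
    eval-withRoots-nonroot {suc m} r t t∉r ≡0
      with zero-product (≡.trans (≡.sym (eval-mulLinear (- r zero) (withRoots (r ∘ suc)) t)) ≡0)
    ... | inj₁ t-r₀≡0 = t∉r zero (x∙y⁻¹≈ε⇒x≈y t (r zero) t-r₀≡0)
    ... | inj₂ ≡0′    = eval-withRoots-nonroot (r ∘ suc) t (t∉r ∘ suc) ≡0′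

module Fp (q : ℕ) (prime : Prime (suc q)) where
  open PrimeField (suc q) prime
  open ≡-Reasoning

  private
    toℕ-red : ∀ m → toℕ (red m) ≡ m % suc q
    toℕ-red m = toℕ-fromℕ< _

    red-toℕ : ∀ a → red (toℕ a) ≡ a
    red-toℕ a = toℕ-injective (≡.trans (toℕ-red (toℕ a)) (m<n⇒m%n≡m (toℕ<n a)))

    red-% : ∀ m → red (m % suc q) ≡ red m
    red-% m = toℕ-injective
      (≡.trans (toℕ-red (m % suc q)) (≡.trans (m%n%n≡m%n m (suc q)) (≡.sym (toℕ-red m))))

    red-+ : ∀ m n → red (m ℕ.+ n) ≡ red m +F red n
    red-+ m n = begin
      red (m ℕ.+ n)                             ≡⟨ red-% (m ℕ.+ n) ⟨
      red ((m ℕ.+ n) % suc q)                   ≡⟨ ≡.cong red (%-distribˡ-+ m n (suc q)) ⟩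
      red ((m % suc q ℕ.+ n % suc q) % suc q)   ≡⟨ red-% (m % suc q ℕ.+ n % suc q) ⟩
      red (m % suc q ℕ.+ n % suc q)             ≡⟨ ≡.cong₂ (λ x y → red (x ℕ.+ y)) (toℕ-red m) (toℕ-red n) ⟨
      red m +F red n                            ∎

    red-* : ∀ m n → red (m ℕ.* n) ≡ red m *F red n
    red-* m n = begin
      red (m ℕ.* n)                               ≡⟨ red-% (m ℕ.* n) ⟨
      red ((m ℕ.* n) % suc q)                     ≡⟨ ≡.cong red (%-distribˡ-* m n (suc q)) ⟩
      red ((m % suc q ℕ.* (n % suc q)) % suc q)   ≡⟨ red-% (m % suc q ℕ.* (n % suc q)) ⟩
      red (m % suc q ℕ.* (n % suc q))             ≡⟨ ≡.cong₂ (λ x y → red (x ℕ.* y)) (toℕ-red m) (toℕ-red n) ⟨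
      red m *F red n                              ∎

    red[p]≡0 : red (suc q) ≡ 0F
    red[p]≡0 = toℕ-injective (≡.trans (toℕ-red (suc q)) (n%n≡0 (suc q)))

    negF : F → F
    negF a = red (suc q ∸ toℕ a)

    +F-comm : ∀ a b → a +F b ≡ b +F a
    +F-comm a b = ≡.cong red (ℕₚ.+-comm (toℕ a) (toℕ b))

    *F-comm : ∀ a b → a *F b ≡ b *F a
    *F-comm a b = ≡.cong red (ℕₚ.*-comm (toℕ a) (toℕ b))

    +F-assoc : ∀ a b c → (a +F b) +F c ≡ a +F (b +F c)
    +F-assoc a b c = begin
      red (A ℕ.+ B) +F c       ≡⟨ ≡.cong (red (A ℕ.+ B) +F_) (red-toℕ c) ⟨
      red (A ℕ.+ B) +F red C   ≡⟨ red-+ (A ℕ.+ B) C ⟨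
      red (A ℕ.+ B ℕ.+ C)      ≡⟨ ≡.cong red (ℕₚ.+-assoc A B C) ⟩
      red (A ℕ.+ (B ℕ.+ C))    ≡⟨ red-+ A (B ℕ.+ C) ⟩
      red A +F red (B ℕ.+ C)   ≡⟨ ≡.cong (_+F (b +F c)) (red-toℕ a) ⟩
      a +F (b +F c)            ∎
      where A = toℕ a; B = toℕ b; C = toℕ c

    *F-assoc : ∀ a b c → (a *F b) *F c ≡ a *F (b *F c)
    *F-assoc a b c = begin
      red (A ℕ.* B) *F c       ≡⟨ ≡.cong (red (A ℕ.* B) *F_) (red-toℕ c) ⟨
      red (A ℕ.* B) *F red C   ≡⟨ red-* (A ℕ.* B) C ⟨
      red (A ℕ.* B ℕ.* C)      ≡⟨ ≡.cong red (ℕₚ.*-assoc A B C) ⟩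
      red (A ℕ.* (B ℕ.* C))    ≡⟨ red-* A (B ℕ.* C) ⟩
      red A *F red (B ℕ.* C)   ≡⟨ ≡.cong (_*F (b *F c)) (red-toℕ a) ⟩
      a *F (b *F c)            ∎
      where A = toℕ a; B = toℕ b; C = toℕ c

    *F-distribʳ : ∀ a b c → (b +F c) *F a ≡ (b *F a) +F (c *F a)
    *F-distribʳ a b c = begin
      red (B ℕ.+ C) *F a          ≡⟨ ≡.cong (red (B ℕ.+ C) *F_) (red-toℕ a) ⟨
      red (B ℕ.+ C) *F red A      ≡⟨ red-* (B ℕ.+ C) A ⟨
      red ((B ℕ.+ C) ℕ.* A)       ≡⟨ ≡.cong red (ℕₚ.*-distribʳ-+ A B C) ⟩
      red (B ℕ.* A ℕ.+ C ℕ.* A)   ≡⟨ red-+ (B ℕ.* A) (C ℕ.* A) ⟩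
      (b *F a) +F (c *F a)        ∎
      where A = toℕ a; B = toℕ b; C = toℕ c

    +F-identityˡ : ∀ a → 0F +F a ≡ a
    +F-identityˡ = red-toℕ

    *F-identityˡ : ∀ a → 1F *F a ≡ a
    *F-identityˡ a = begin
      1F *F a          ≡⟨ ≡.cong (1F *F_) (red-toℕ a) ⟨
      red 1 *F red A   ≡⟨ red-* 1 A ⟨
      red (1 ℕ.* A)    ≡⟨ ≡.cong red (ℕₚ.*-identityˡ A) ⟩
      red A            ≡⟨ red-toℕ a ⟩
      a                ∎
      where A = toℕ a

    negF‿inverseˡ : ∀ a → negF a +F a ≡ 0F
    negF‿inverseˡ a = begin
      negF a +F a                ≡⟨ ≡.cong (negF a +F_) (red-toℕ a) ⟨
      red (suc q ∸ A) +F red A   ≡⟨ red-+ (suc q ∸ A) A ⟨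
      red (suc q ∸ A ℕ.+ A)      ≡⟨ ≡.cong red (ℕₚ.m∸n+n≡m (ℕₚ.<⇒≤ (toℕ<n a))) ⟩
      red (suc q)                ≡⟨ red[p]≡0 ⟩
      0F                         ∎
      where A = toℕ a

  isCommutativeRing : IsCommutativeRing _≡_ _+F_ _*F_ negF 0F 1F
  isCommutativeRing = record
    { isRing = record
      { +-isAbelianGroup = record
        { isGroup = record
          { isMonoid = record
            { isSemigroup = record
              { isMagma = record { isEquivalence = ≡.isEquivalence ; ∙-cong = ≡.cong₂ _+F_ }
              ; assoc = +F-assoc }
            ; identity = comm∧idˡ⇒id +F-comm +F-identityˡ }
          ; inverse = comm∧invˡ⇒inv +F-comm negF‿inverseˡ
          ; ⁻¹-cong = ≡.cong negF }
        ; comm = +F-comm }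
      ; *-cong = ≡.cong₂ _*F_
      ; *-assoc = *F-assoc
      ; *-identity = comm∧idˡ⇒id *F-comm *F-identityˡ
      ; distrib = comm∧distrʳ⇒distr (≡.cong₂ _+F_) *F-comm *F-distribʳ }
    ; *-comm = *F-comm }

  open Polynomials isCommutativeRing
  open CommutativeRing commutativeRing
    using (_+_; _*_; -_; _-_; 0#; 1#; +-assoc; *-assoc; +-identityˡ; +-identityʳ; *-identityʳ;
           zeroˡ; zeroʳ; *-comm; distribʳ; -‿inverseʳ; semiring; +-group)
  open import Algebra.Properties.Group +-group using (x∙y⁻¹≈ε⇒x≈y)
  open import Algebra.Properties.Semiring.Sum semiring
    using (sum-syntax; sum-cong-≗; ∑-distrib-+; *-distribʳ-sum; sum-replicate-zero)
  open RingSolver commutativeRing using (solve; _:=_; _:+_; _:*_; :-_)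

  private
    red-*-toℕ : ∀ y a → red (y ℕ.* toℕ a) ≡ red y * a
    red-*-toℕ y a = ≡.trans (red-* y (toℕ a)) (≡.cong (red y *_) (red-toℕ a))

    red-*-p : ∀ x → red (x ℕ.* suc q) ≡ 0#
    red-*-p x = ≡.trans (red-* x (suc q)) (≡.trans (≡.cong (red x *_) red[p]≡0) (zeroʳ (red x)))

  1#≢0# : 1# ≢ 0#
  1#≢0# 1≡0 = ℕₚ.1+n≢0 (begin
    1           ≡⟨ m<n⇒m%n≡m (ℕ.nonTrivial⇒n>1 (suc q) {{prime⇒nonTrivial prime}}) ⟨
    1 % suc q   ≡⟨ toℕ-red 1 ⟨
    toℕ 1#      ≡⟨ ≡.cong toℕ 1≡0 ⟩
    0           ∎)

  zero-product : ∀ {a b} → a * b ≡ 0# → a ≡ 0# ⊎ b ≡ 0#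
  zero-product {a} {b} ab≡0 =
    Sum.map p∣⇒≡0 p∣⇒≡0 (euclidsLemma (toℕ a) (toℕ b) prime (m%n≡0⇒n∣m (toℕ a ℕ.* toℕ b) (suc q)
      (≡.trans (≡.sym (toℕ-red (toℕ a ℕ.* toℕ b))) (≡.cong toℕ ab≡0))))
    where
    p∣⇒≡0 : ∀ {a} → suc q ∣ toℕ a → a ≡ 0#
    p∣⇒≡0 {zero}  _   = refl
    p∣⇒≡0 {suc a} p∣a = contradiction p∣a (>⇒∤ (toℕ<n (suc a)))

  inverse : ∀ {a} → a ≢ 0# → ∃[ b ] a * b ≡ 1#
  inverse {zero}  0≢0 = contradiction refl 0≢0
  inverse {suc k} _   with coprime-Bézout (prime⇒coprime prime (toℕ<n (suc k)))
  ... | Bézout.-+ x y 1+xp≡ya = red y , (begin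
    a * red y                 ≡⟨ *-comm a (red y) ⟩
    red y * a                 ≡⟨ red-*-toℕ y a ⟨
    red (y ℕ.* toℕ a)         ≡⟨ ≡.cong red 1+xp≡ya ⟨
    red (1 ℕ.+ x ℕ.* suc q)   ≡⟨ red-+ 1 (x ℕ.* suc q) ⟩
    1# + red (x ℕ.* suc q)    ≡⟨ ≡.cong (1# +_) (red-*-p x) ⟩
    1# + 0#                   ≡⟨ +-identityʳ 1# ⟩
    1#                        ∎)
    where a = suc k
  ... | Bézout.+- x y 1+ya≡xp = - red y , (begin
    a * - red y                      ≡⟨ +-identityʳ _ ⟨
    a * - red y + 0#                 ≡⟨ ≡.cong (a * - red y +_) 1+ya≡0 ⟨
    a * - red y + (1# + red y * a)   ≡⟨ solve 3 (λ a y o → a :* :- y :+ (o :+ y :* a) := o) refl a (red y) 1# ⟩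
    1#                               ∎)
    where
    a = suc k
    1+ya≡0 : 1# + red y * a ≡ 0#
    1+ya≡0 = begin
      1# + red y * a            ≡⟨ ≡.cong (1# +_) (red-*-toℕ y a) ⟨
      1# + red (y ℕ.* toℕ a)    ≡⟨ red-+ 1 (y ℕ.* toℕ a) ⟨
      red (1 ℕ.+ y ℕ.* toℕ a)   ≡⟨ ≡.cong red 1+ya≡xp ⟩
      red (x ℕ.* suc q)         ≡⟨ red-*-p x ⟩
      0#                        ∎

  open IntegralDomain 1#≢0# zero-product

  -- The nonzero elements of F = Fin (suc q) are exactly the suc k.
  withNonzeroRoots : Vec F (suc q)
  withNonzeroRoots = withRoots suc

  private
    c₀ : F
    c₀ = eval withNonzeroRoots 0#

    c₀≢0 : c₀ ≢ 0#
    c₀≢0 = eval-withRoots-nonroot suc 0# λ _ ()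

    c₀⁻¹ : F
    c₀⁻¹ = proj₁ (inverse c₀≢0)

  -- Lagrange interpolation: c₀⁻¹ · withNonzeroRoots takes the value 1 at 0 and 0 elsewhere.
  interpolant : (F → F) → Vec F (suc q)
  interpolant G = tabulate λ k → ∑[ a < suc q ] (G a * c₀⁻¹ * lookup (shift (- a) withNonzeroRoots) k)

  eval-interpolant : ∀ G t → eval (interpolant G) t ≡ G t
  eval-interpolant G t = begin
    eval (interpolant G) t
      ≡⟨ eval-∑ (λ a → G a * c₀⁻¹) (λ a → shift (- a) withNonzeroRoots) t ⟩
    ∑[ a < suc q ] (G a * c₀⁻¹ * eval (shift (- a) withNonzeroRoots) t)
      ≡⟨ sum-cong-≗ (λ a → ≡.cong (G a * c₀⁻¹ *_) (eval-shift (- a) withNonzeroRoots t)) ⟩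
    ∑[ a < suc q ] (G a * c₀⁻¹ * eval withNonzeroRoots (t - a))
      ≡⟨ sum-pick (λ a → G a * c₀⁻¹ * eval withNonzeroRoots (t - a)) t only-t ⟩
    G t * c₀⁻¹ * eval withNonzeroRoots (t - t)
      ≡⟨ ≡.cong (λ x → G t * c₀⁻¹ * eval withNonzeroRoots x) (-‿inverseʳ t) ⟩
    G t * c₀⁻¹ * c₀
      ≡⟨ solve 3 (λ g i c → g :* i :* c := g :* (c :* i)) refl (G t) c₀⁻¹ c₀ ⟩
    G t * (c₀ * c₀⁻¹)
      ≡⟨ ≡.cong (G t *_) (proj₂ (inverse c₀≢0)) ⟩
    G t * 1#
      ≡⟨ *-identityʳ (G t) ⟩
    G t
      ∎
    where
    vanishes-off-0 : ∀ s → s ≢ 0# → eval withNonzeroRoots s ≡ 0#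
    vanishes-off-0 zero    s≢0 = contradiction refl s≢0
    vanishes-off-0 (suc k) _   = eval-withRoots suc k
    only-t : ∀ a → a ≢ t → G a * c₀⁻¹ * eval withNonzeroRoots (t - a) ≡ 0#
    only-t a a≢t = begin
      G a * c₀⁻¹ * eval withNonzeroRoots (t - a)
        ≡⟨ ≡.cong (G a * c₀⁻¹ *_) (vanishes-off-0 (t - a) (a≢t ∘ ≡.sym ∘ x∙y⁻¹≈ε⇒x≈y t a)) ⟩
      G a * c₀⁻¹ * 0#
        ≡⟨ zeroʳ (G a * c₀⁻¹) ⟩
      0#
        ∎

  difference-top-coefficient≡0 : (G : F → F) (b : Vec F (suc q)) →
                                 (∀ t → G (t + 1#) - G t ≡ eval b t) → lookup b (fromℕ q) ≡ 0#
  difference-top-coefficient≡0 G b ΔG≡b = begin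
    lookup b (fromℕ q)                                   ≡⟨ ≡.cong (λ v → lookup v (fromℕ q)) b≡Δg ⟩
    lookup (zipWith _-_ (shift 1# g) g) (fromℕ q)        ≡⟨ lookup-zipWith _-_ (fromℕ q) (shift 1# g) g ⟩
    lookup (shift 1# g) (fromℕ q) - lookup g (fromℕ q)   ≡⟨ ≡.cong (_- lookup g (fromℕ q)) (lookup-shift-last 1# g) ⟩
    lookup g (fromℕ q) - lookup g (fromℕ q)              ≡⟨ -‿inverseʳ (lookup g (fromℕ q)) ⟩
    0#                                                   ∎
    where
    g = interpolant G
    b≡Δg : b ≡ zipWith _-_ (shift 1# g) g
    b≡Δg = eval-injective id id b (zipWith _-_ (shift 1# g) g) λ t → begin
      eval b t                              ≡⟨ ΔG≡b t ⟨
      G (t + 1#) - G t                      ≡⟨ ≡.cong₂ _-_ (eval-interpolant G (t + 1#)) (eval-interpolant G t) ⟨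
      eval g (t + 1#) - eval g t            ≡⟨ ≡.cong (_- eval g t) (eval-shift 1# g t) ⟨
      eval (shift 1# g) t - eval g t        ≡⟨ eval-zipWith-sub (shift 1# g) g t ⟨
      eval (zipWith _-_ (shift 1# g) g) t   ∎

  -F≡- : ∀ a b → a -F b ≡ a - b
  -F≡- a b = ≡.trans (red-+ (toℕ a) (suc q ∸ toℕ b)) (≡.cong (_+ - b) (red-toℕ a))

  Δ-e-zero : ∀ {n} (g : Vec F (suc n) → F) y xs →
             Δ (e zero) g (y ∷ xs) ≡ g ((y + 1#) ∷ xs) - g (y ∷ xs)
  Δ-e-zero g y xs = begin
    g ((y + 1#) ∷ xs +V tabulate (λ _ → 0#)) -F g (y ∷ xs)
      ≡⟨ -F≡- (g ((y + 1#) ∷ xs +V tabulate (λ _ → 0#))) (g (y ∷ xs)) ⟩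
    g ((y + 1#) ∷ xs +V tabulate (λ _ → 0#)) - g (y ∷ xs)
      ≡⟨ ≡.cong (λ v → g ((y + 1#) ∷ v) - g (y ∷ xs)) (+V-zeros xs) ⟩
    g ((y + 1#) ∷ xs) - g (y ∷ xs)
      ∎
    where
    +V-zeros : ∀ {n} (x : Vec F n) → x +V tabulate (λ _ → 0#) ≡ x
    +V-zeros []       = refl
    +V-zeros (x ∷ xs) = ≡.cong₂ _∷_ (+-identityʳ x) (+V-zeros xs)

  Δ-e-suc : ∀ {n} (g : Vec F (suc n) → F) j y xs → Δ (e (suc j)) g (y ∷ xs) ≡ Δ (e j) (g ∘ (y ∷_)) xs
  Δ-e-suc g j y xs = ≡.cong (λ z → g (z ∷ xs +V e j) -F g (y ∷ xs)) (+-identityʳ y)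

  private
    sumF-map-++ : ∀ {A : Set} (f : A → F) xs ys →
                  sumF (map f (xs List.++ ys)) ≡ sumF (map f xs) + sumF (map f ys)
    sumF-map-++ f []       ys = ≡.sym (+-identityˡ (sumF (map f ys)))
    sumF-map-++ f (x ∷ xs) ys = ≡.trans (≡.cong (f x +_) (sumF-map-++ f xs ys))
                                        (≡.sym (+-assoc (f x) (sumF (map f xs)) (sumF (map f ys))))

    sumF-map-concatMap : ∀ {A B : Set} (f : B → F) (h : A → List B) xs →
                         sumF (map f (concatMap h xs)) ≡ sumF (map (λ a → sumF (map f (h a))) xs)
    sumF-map-concatMap f h []       = refl
    sumF-map-concatMap f h (x ∷ xs) = ≡.trans (sumF-map-++ f (h x) (concatMap h xs))
                                              (≡.cong (sumF (map f (h x)) +_) (sumF-map-concatMap f h xs))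

    sumF-map-tabulate : ∀ {A : Set} {m} (f : A → F) (h : Fin m → A) →
                        sumF (map f (List.tabulate h)) ≡ ∑[ a < m ] f (h a)
    sumF-map-tabulate {m = zero}  f h = refl
    sumF-map-tabulate {m = suc m} f h = ≡.cong (f (h zero) +_) (sumF-map-tabulate f (h ∘ suc))

    sumF-map-*ʳ : ∀ {A : Set} (f : A → F) w xs → sumF (map (λ z → f z * w) xs) ≡ sumF (map f xs) * w
    sumF-map-*ʳ f w []       = ≡.sym (zeroˡ w)
    sumF-map-*ʳ f w (x ∷ xs) = ≡.trans (≡.cong (f x * w +_) (sumF-map-*ʳ f w xs))
                                       (≡.sym (distribʳ w (f x) (sumF (map f xs))))

    sumF-map-∑ : ∀ {A : Set} {m} (f : Fin m → A → F) xs →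
                 sumF (map (λ z → ∑[ a < m ] f a z) xs) ≡ ∑[ a < m ] sumF (map (f a) xs)
    sumF-map-∑ {m = m} f []       = ≡.sym (sum-replicate-zero m)
    sumF-map-∑         f (x ∷ xs) = ≡.trans (≡.cong (∑[ a < _ ] f a x +_) (sumF-map-∑ f xs))
                                            (≡.sym (∑-distrib-+ (λ a → f a x) λ a → sumF (map (f a) xs)))

    ^F≡^ : ∀ a k → a ^F k ≡ a ^ k
    ^F≡^ a zero    = refl
    ^F≡^ a (suc k) = ≡.cong (a *_) (^F≡^ a k)

  anf : ∀ {n} → (Vec (Fin (suc q)) n → F) → Vec F n → F
  anf {n} c x = sumF (map (λ is → c is * monomial is x) (allExps n))

  anf-cong : ∀ {n} {c c′ : Vec (Fin (suc q)) n → F} → (∀ is → c is ≡ c′ is) →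
             ∀ x → anf c x ≡ anf c′ x
  anf-cong {n} c≗c′ x = ≡.cong sumF (map-cong (λ is → ≡.cong (_* monomial is x) (c≗c′ is)) (allExps n))

  anf-*ʳ : ∀ {n} (c : Vec (Fin (suc q)) n → F) w x → anf (λ is → c is * w) x ≡ anf c x * w
  anf-*ʳ {n} c w x = ≡.trans
    (≡.cong sumF (map-cong (λ is → solve 3 (λ c w m → c :* w :* m := c :* m :* w) refl (c is) w (monomial is x))
                           (allExps n)))
    (sumF-map-*ʳ (λ is → c is * monomial is x) w (allExps n))

  anf-∑ : ∀ {n m} (c : Fin m → Vec (Fin (suc q)) n → F) x →
          anf (λ is → ∑[ a < m ] c a is) x ≡ ∑[ a < m ] anf (c a) x
  anf-∑ {n} c x = ≡.trans
    (≡.cong sumF (map-cong (λ is → *-distribʳ-sum (monomial is x) λ a → c a is) (allExps n)))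
    (sumF-map-∑ (λ a is → c a is * monomial is x) (allExps n))

  anf-zero : ∀ {n} (x : Vec F n) → anf (λ _ → 0#) x ≡ 0#
  anf-zero x = anf-∑ {m = 0} (λ ()) x  -- 0# is the empty sum

  anf-∷ : ∀ {n} (c : Vec (Fin (suc q)) (suc n) → F) y xs →
          anf c (y ∷ xs) ≡ ∑[ a < suc q ] anf (λ js → c (a ∷ js) * y ^ toℕ a) xs
  anf-∷ {n} c y xs = begin
    sumF (map T (concatMap (λ a → map (a ∷_) (allExps n)) (allFin (suc q))))
      ≡⟨ sumF-map-concatMap T (λ a → map (a ∷_) (allExps n)) (allFin (suc q)) ⟩
    sumF (map (λ a → sumF (map T (map (a ∷_) (allExps n)))) (allFin (suc q)))
      ≡⟨ sumF-map-tabulate (λ a → sumF (map T (map (a ∷_) (allExps n)))) id ⟩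
    ∑[ a < suc q ] sumF (map T (map (a ∷_) (allExps n)))
      ≡⟨ sum-cong-≗ (λ a → ≡.cong sumF (map-∘ {g = T} {f = a ∷_} (allExps n))) ⟨
    ∑[ a < suc q ] sumF (map (T ∘ (a ∷_)) (allExps n))
      ≡⟨ sum-cong-≗ (λ a → ≡.cong sumF (map-cong (regroup a) (allExps n))) ⟩
    ∑[ a < suc q ] anf (λ js → c (a ∷ js) * y ^ toℕ a) xs
      ∎
    where
    T : Vec (Fin (suc q)) (suc n) → F
    T is = c is * monomial is (y ∷ xs)
    regroup : ∀ a js → T (a ∷ js) ≡ c (a ∷ js) * y ^ toℕ a * monomial js xs
    regroup a js = ≡.trans (≡.cong (λ u → c (a ∷ js) * (u * monomial js xs)) (^F≡^ y (toℕ a)))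
                           (≡.sym (*-assoc (c (a ∷ js)) (y ^ toℕ a) (monomial js xs)))

  anf-∷-outer : ∀ {n} (c : Vec (Fin (suc q)) (suc n) → F) y xs →
                anf c (y ∷ xs) ≡ eval (tabulate λ a → anf (c ∘ (a ∷_)) xs) y
  anf-∷-outer c y xs = begin
    anf c (y ∷ xs)
      ≡⟨ anf-∷ c y xs ⟩
    ∑[ a < suc q ] anf (λ js → c (a ∷ js) * y ^ toℕ a) xs
      ≡⟨ sum-cong-≗ (λ a → anf-*ʳ (c ∘ (a ∷_)) (y ^ toℕ a) xs) ⟩
    ∑[ a < suc q ] (anf (c ∘ (a ∷_)) xs * y ^ toℕ a)
      ≡⟨ eval-tabulate (λ a → anf (c ∘ (a ∷_)) xs) y ⟨
    eval (tabulate λ a → anf (c ∘ (a ∷_)) xs) y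
      ∎

  anf-∷-inner : ∀ {n} (c : Vec (Fin (suc q)) (suc n) → F) y xs →
                anf c (y ∷ xs) ≡ anf (λ js → eval (tabulate λ a → c (a ∷ js)) y) xs
  anf-∷-inner c y xs = begin
    anf c (y ∷ xs)
      ≡⟨ anf-∷ c y xs ⟩
    ∑[ a < suc q ] anf (λ js → c (a ∷ js) * y ^ toℕ a) xs
      ≡⟨ anf-∑ (λ a js → c (a ∷ js) * y ^ toℕ a) xs ⟨
    anf (λ js → ∑[ a < suc q ] (c (a ∷ js) * y ^ toℕ a)) xs
      ≡⟨ anf-cong (λ js → eval-tabulate (λ a → c (a ∷ js)) y) xs ⟨
    anf (λ js → eval (tabulate λ a → c (a ∷ js)) y) xs
      ∎

  anf-injective : ∀ {n} (c c′ : Vec (Fin (suc q)) n → F) → (∀ x → anf c x ≡ anf c′ x) →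
                  ∀ is → c is ≡ c′ is
  anf-injective {zero} c c′ agree [] = begin
    c []        ≡⟨ anf-[] c ⟨
    anf c []    ≡⟨ agree [] ⟩
    anf c′ []   ≡⟨ anf-[] c′ ⟩
    c′ []       ∎
    where
    anf-[] : ∀ c → anf c [] ≡ c []
    anf-[] c = ≡.trans (+-identityʳ (c [] * 1#)) (*-identityʳ (c []))
  anf-injective {suc n} c c′ agree (a ∷ js) =
    anf-injective (c ∘ (a ∷_)) (c′ ∘ (a ∷_)) (λ xs → coefficients-agree xs a) js
    where
    coefficients-agree : ∀ xs a → anf (c ∘ (a ∷_)) xs ≡ anf (c′ ∘ (a ∷_)) xs
    coefficients-agree xs =
      eval-tabulate-injective id id (λ a → anf (c ∘ (a ∷_)) xs) (λ a → anf (c′ ∘ (a ∷_)) xs) λ y → begin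
        eval (tabulate λ a → anf (c ∘ (a ∷_)) xs) y    ≡⟨ anf-∷-outer c y xs ⟨
        anf c (y ∷ xs)                                 ≡⟨ agree (y ∷ xs) ⟩
        anf c′ (y ∷ xs)                                ≡⟨ anf-∷-outer c′ y xs ⟩
        eval (tabulate λ a → anf (c′ ∘ (a ∷_)) xs) y   ∎

  -- For j = 0 the coefficients of x₁^(p−1) form the top coefficient of a difference in x₁;
  -- for j + 1, fix the first variable to each y and conclude by uniqueness in y.
  Δ-anf-top≡0 : ∀ {n} (g : Vec F n → F) j (c : Vec (Fin (suc q)) n → F) → IsANF c (Δ (e j) g) →
                ∀ is → lookup is j ≡ fromℕ q → c is ≡ 0#
  Δ-anf-top≡0 g zero c c-anf (a ∷ js) refl =
    anf-injective (c ∘ (fromℕ q ∷_)) (λ _ → 0#) (λ xs → ≡.trans (top≡0 xs) (≡.sym (anf-zero xs))) js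
    where
    top≡0 : ∀ xs → anf (c ∘ (fromℕ q ∷_)) xs ≡ 0#
    top≡0 xs = begin
      anf (c ∘ (fromℕ q ∷_)) xs
        ≡⟨ lookup∘tabulate (λ a → anf (c ∘ (a ∷_)) xs) (fromℕ q) ⟨
      lookup (tabulate λ a → anf (c ∘ (a ∷_)) xs) (fromℕ q)
        ≡⟨ difference-top-coefficient≡0 (λ t → g (t ∷ xs)) (tabulate λ a → anf (c ∘ (a ∷_)) xs) Δg≡ ⟩
      0#
        ∎
      where
      Δg≡ : ∀ t → g ((t + 1#) ∷ xs) - g (t ∷ xs) ≡ eval (tabulate λ a → anf (c ∘ (a ∷_)) xs) t
      Δg≡ t = begin
        g ((t + 1#) ∷ xs) - g (t ∷ xs)                ≡⟨ Δ-e-zero g t xs ⟨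
        Δ (e zero) g (t ∷ xs)                         ≡⟨ c-anf (t ∷ xs) ⟩
        anf c (t ∷ xs)                                ≡⟨ anf-∷-outer c t xs ⟩
        eval (tabulate λ a → anf (c ∘ (a ∷_)) xs) t   ∎
  Δ-anf-top≡0 {suc n} g (suc j) c c-anf (a ∷ js) js[j]≡top =
    eval-tabulate-injective id id (λ a → c (a ∷ js)) (λ _ → 0#) vanishes a
    where
    c-at : F → Vec (Fin (suc q)) n → F
    c-at y js = eval (tabulate λ a → c (a ∷ js)) y
    c-at-anf : ∀ y → IsANF (c-at y) (Δ (e j) (g ∘ (y ∷_)))
    c-at-anf y xs = begin
      Δ (e j) (g ∘ (y ∷_)) xs      ≡⟨ Δ-e-suc g j y xs ⟨
      Δ (e (suc j)) g (y ∷ xs)     ≡⟨ c-anf (y ∷ xs) ⟩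
      anf c (y ∷ xs)               ≡⟨ anf-∷-inner c y xs ⟩
      anf (c-at y) xs              ∎
    vanishes : ∀ y → c-at y js ≡ eval (tabulate {n = suc q} λ _ → 0#) y
    vanishes y = ≡.trans (Δ-anf-top≡0 (g ∘ (y ∷_)) j (c-at y) (c-at-anf y) js js[j]≡top)
                         (≡.sym (eval-zeros {suc q} y))

  degIn-cong : ∀ {n} k {c c′ : Vec (Fin (suc q)) n → F} → (∀ is → c is ≡ c′ is) →
               degIn k c ≡ degIn k c′
  degIn-cong {n} k c≗c′ = ≡.cong (List.foldr _⊔_ 0)
    (map-cong (λ is → ≡.cong (λ v → if does (v ≟ 0F) then 0 else toℕ (lookup is k)) (c≗c′ is)) (allExps n))

  degIn<q : ∀ {n} k (c : Vec (Fin (suc q)) n → F) → (∀ is → lookup is k ≡ fromℕ q → c is ≡ 0#) →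
            degIn k c < q
  degIn<q {n} k c top≡0 =
    foldr-preservesᵇ {P = _< q} ℕₚ.⊔-lub 0<q (All.map⁺ (All.universal bound (allExps n)))
    where
    0<q : 0 < q
    0<q = ℕₚ.≤-pred (ℕ.nonTrivial⇒n>1 (suc q) {{prime⇒nonTrivial prime}})
    bound : ∀ is → (if does (c is ≟ 0F) then 0 else toℕ (lookup is k)) < q
    bound is with c is ≟ 0F
    ... | yes _  = 0<q
    ... | no c≢0 = ℕₚ.≤∧≢⇒< (toℕ≤pred[n] (lookup is k)) λ ≡q →
                     c≢0 (top≡0 is (toℕ-injective (≡.trans ≡q (≡.sym (toℕ-fromℕ q)))))

lemma3 : (p : ℕ) (pp : Prime p) (n : ℕ) →
    let open PrimeField p pp in
    (f g : Vec F n → F) (i j : Fin n) → i ≢ j →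
    (∀ x → Δ (e i) f x ≡ Δ (e j) g x) →
    (cf cg : Vec (Fin p) n → F) → IsANF cf (Δ (e i) f) → IsANF cg (Δ (e j) g) →
    (degIn j cf ≡ degIn j cg × degIn j cf < p ∸ 1)
      × (degIn i cg ≡ degIn i cf × degIn i cg < p ∸ 1)
lemma3 zero    pp = contradiction pp ¬prime[0]
lemma3 (suc q) pp n f g i j _ Δf≡Δg cf cg cf-anf cg-anf =
    ( degIn-cong j cf≗cg
    , degIn<q j cf λ is top → ≡.trans (cf≗cg is) (Δ-anf-top≡0 g j cg cg-anf is top) )
  , ( degIn-cong i (≡.sym ∘ cf≗cg)
    , degIn<q i cg λ is top → ≡.trans (≡.sym (cf≗cg is)) (Δ-anf-top≡0 f i cf cf-anf is top) )
  where
  open Fp q pp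
  cf≗cg : ∀ is → cf is ≡ cg is
  cf≗cg = anf-injective cf cg λ x → ≡.trans (≡.sym (cf-anf x)) (≡.trans (Δf≡Δg x) (cg-anf x))
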